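{- Let $m,n>0$. An $m$-Dyck path $\mathfrak{p}\in D_n^{(m)}$ is join-irreducible in $\mathcal{T}_n^{(m)}$ if and only if there exist indices $1\le i<k\le n$ and $s\in\{1,2,\ldots,m\}$ such that its step sequence $(u_1,\ldots,u_n)$ satisfies $u_j=m(j-1)-s$ for $j\in\{i+1,i+2,\ldots,k\}$ and $u_j=m(j-1)$ for $j\notin\{i+1,\ldots,k\}$.
   Context: An $m$-Dyck path of length $(m+1)n$ is a lattice path from $(0,0)$ to $(mn,n)$ with north-steps and east-steps staying weakly above the line $x=my$; $D_n^{(m)}$ is their set. Its step sequence $(u_1,\dots,u_n)$ records the $x$-coordinate $u_k$ of the $k$-th north-step (so $u_1\le\cdots\le u_n$, $u_k\le m(k-1)$). The primitive subsequence at position $i$ is $(u_i,\dots,u_k)$ with $k\ge i$ the largest index such that $u_j-u_i<m(j-i)$ for all $i<j\le k$. Set $\mathfrak p\lessdot_{\mathrm{rot}}\mathfrak p'$ if the step sequence of $\mathfrak p'$ is obtained from that of $\mathfrak p$ by decreasing each entry of the primitive subsequence at some position $i\in\{2,\dots,n\}$ with $u_{i-1}<u_i$ by $1$. The rotation order $\le_{\mathrm{rot}}$ is its reflexive transitive closure, and $\mathcal T_n^{(m)}=(D_n^{(m)},\le_{\mathrm{rot}})$. An element is join-irreducible if it is not minimal and has exactly one lower cover. -}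

module Defs where

open import Data.Nat using (ℕ; suc; _+_; _*_; _≤_; _<_)
open import Data.Fin as Fin using (Fin; toℕ)
open import Data.Vec using (Vec; lookup)
open import Data.Product using (Σ; ∃; ∃-syntax; _×_; _,_)
open import Relation.Nullary using (¬_)
open import Relation.Binary.PropositionalEquality using (_≡_; _≢_)
open import Relation.Binary.Construct.Closure.ReflexiveTransitive using (Star)

-- Indices are 0-based: position j : Fin n stands for the (toℕ j + 1)-th north step.
-- So the paper's u_k is  lookup u (k-1)  and the bound u_k ≤ m(k-1) reads
-- lookup u j ≤ m * toℕ j.

record DyckPath (m n : ℕ) : Set where
  constructor dyck
  field
    seq   : Vec ℕ n
    mono  : (i j : Fin n) → toℕ i ≤ toℕ j → lookup seq i ≤ lookup seq j
    bound : (j : Fin n) → lookup seq j ≤ m * toℕ j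
open DyckPath public

-- j belongs to the primitive subsequence at position i of u:
-- i ≤ j and for all i < j' ≤ j,  u_{j'} - u_i < m (j' - i)
-- (written without truncated subtraction as u_{j'} + m i < u_i + m j').
InPrim : ∀ {n} (m : ℕ) → Vec ℕ n → Fin n → Fin n → Set
InPrim {n} m u i j =
  toℕ i ≤ toℕ j ×
  ((j' : Fin n) → toℕ i < toℕ j' → toℕ j' ≤ toℕ j →
     lookup u j' + m * toℕ i < lookup u i + m * toℕ j')

-- Elementary rotation  p ⋖rot p' : there is a position i ∈ {2,…,n}
-- (0-based: i = i₀ + 1 for some position i₀) with u_{i-1} < u_i, and p' is
-- obtained from p by decreasing every entry of the primitive subsequence at i by 1.
RotStep : ∀ {m n} → DyckPath m n → DyckPath m n → Set
RotStep {m} {n} p p' =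
  Σ (Fin n) λ i₀ → Σ (Fin n) λ i →
    (toℕ i ≡ suc (toℕ i₀)) ×
    (lookup (seq p) i₀ < lookup (seq p) i) ×
    ((j : Fin n) →
       (InPrim m (seq p) i j → lookup (seq p') j + 1 ≡ lookup (seq p) j) ×
       (¬ InPrim m (seq p) i j → lookup (seq p') j ≡ lookup (seq p) j))

_≤rot_ : ∀ {m n} → DyckPath m n → DyckPath m n → Set
p ≤rot q = Star RotStep p q

-- Strict order (paths are identified by their step sequences).
_<rot_ : ∀ {m n} → DyckPath m n → DyckPath m n → Set
p <rot q = (p ≤rot q) × (seq p ≢ seq q)

LowerCover : ∀ {m n} → DyckPath m n → DyckPath m n → Set
LowerCover {m} {n} q p =
  (q <rot p) × ¬ (Σ (DyckPath m n) λ r → (q <rot r) × (r <rot p))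

Minimal : ∀ {m n} → DyckPath m n → Set
Minimal {m} {n} p = ¬ (Σ (DyckPath m n) λ q → q <rot p)

JoinIrreducible : ∀ {m n} → DyckPath m n → Set
JoinIrreducible {m} {n} p =
  ¬ Minimal p ×
  Σ (DyckPath m n) λ q → LowerCover q p ×
    ((q' : DyckPath m n) → LowerCover q' p → seq q' ≡ seq q)

-- Rotations only lower entries of the step sequence u, so its sum strictly decreases along <rot;
-- hence every path strictly below p lies below some lower cover of p. Conversely, raising u by
-- one on an interval [i, e] that becomes the primitive subsequence at i undoes a rotation.
--
-- (⇐) For the stated shape, the only rotation into p is at the last index b of the lowered
-- block, with primitive subsequence {b}; so p has a single lower cover.
-- (⇒) If q is the only lower cover of p, every property of a path rotating into p that rotations
-- preserve passes to q. Raising p at its last off-diagonal index K shows that q is p raised at K.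
-- Raising anywhere else where the defect m k - u k drops would then be contradictory, so the
-- defect is nondecreasing up to K. On the final plateau (a, K] of height s the defect at a must
-- be 0: otherwise the whole plateau could be raised, and q would inherit from that raised path
-- a slack between a and K which its single raised step at K does not have.

module Submission where

open import Defs
open import Data.Nat using (ℕ; zero; suc; _+_; _*_; _∸_; _≤_; _<_; z≤n; s≤s; _≤?_; _<?_; _≟_)
open import Data.Nat.Properties
open import Data.Nat.Tactic.RingSolver using (solve-∀)
open import Algebra.Properties.CommutativeSemigroup +-commutativeSemigroup using (xy∙z≈xz∙y)
open import Data.Fin using (Fin; toℕ; fromℕ<)
open import Data.Fin.Properties using (toℕ-fromℕ<; toℕ<n; all?)
open import Data.Vec using (Vec; []; _∷_; lookup; tabulate; sum)
open import Data.Vec.Properties using (lookup∘tabulate; ≡-dec)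
open import Data.Product using (Σ; _×_; _,_; proj₁; proj₂)
open import Data.Sum using (_⊎_; inj₁; inj₂; [_,_]′)
open import Data.Empty using (⊥; ⊥-elim)
open import Function using (_∘_; id)
open import Function.Bundles using (_⇔_; mk⇔)
open import Relation.Nullary using (¬_; Dec; yes; no)
open import Relation.Nullary.Decidable using (_×-dec_; _→-dec_)
open import Relation.Binary.PropositionalEquality
open import Relation.Binary.Construct.Closure.ReflexiveTransitive using (Star; ε; _◅_; _◅◅_)

-- Reading past the end of a vector yields 0; every use below is guarded by k < n.
infixl 9 _!_
_!_ : ∀ {n} → Vec ℕ n → ℕ → ℕ
[]      ! _     = 0
(x ∷ v) ! zero  = x
(x ∷ v) ! suc k = v ! k

!-lookup : ∀ {n} (v : Vec ℕ n) (j : Fin n) → v ! toℕ j ≡ lookup v j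
!-lookup (x ∷ v) Fin.zero    = refl
!-lookup (x ∷ v) (Fin.suc j) = !-lookup v j

!-fromℕ< : ∀ {n} (v : Vec ℕ n) {k} (k<n : k < n) → lookup v (fromℕ< k<n) ≡ v ! k
!-fromℕ< v k<n = trans (sym (!-lookup v (fromℕ< k<n))) (cong (v !_) (toℕ-fromℕ< k<n))

!-ext : ∀ {n} (v w : Vec ℕ n) → (∀ k → k < n → v ! k ≡ w ! k) → v ≡ w
!-ext []      []      _  = refl
!-ext (x ∷ v) (y ∷ w) eq = cong₂ _∷_ (eq 0 (s≤s z≤n)) (!-ext v w (λ k k<n → eq (suc k) (s≤s k<n)))

!-tabulate : ∀ {n} (f : ℕ → ℕ) {k} → k < n → tabulate {n = n} (f ∘ toℕ) ! k ≡ f k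
!-tabulate {suc n} f {zero}  _         = refl
!-tabulate {suc n} f {suc k} (s≤s k<n) = !-tabulate {n} (f ∘ suc) k<n

infix 4 _≤[_]_
_≤[_]_ : (ℕ → ℕ) → ℕ → (ℕ → ℕ) → Set
u ≤[ n ] v = ∀ k → k < n → u k ≤ v k

⟦_⟧ : ∀ {m n} → DyckPath m n → ℕ → ℕ
⟦ p ⟧ = seq p !_

step-mono : ∀ {m n} (p : DyckPath m n) {k l} → k ≤ l → l < n → ⟦ p ⟧ k ≤ ⟦ p ⟧ l
step-mono p {k} {l} k≤l l<n =
  subst₂ _≤_ (!-fromℕ< (seq p) k<n) (!-fromℕ< (seq p) l<n)
    (mono p (fromℕ< k<n) (fromℕ< l<n)
      (subst₂ _≤_ (sym (toℕ-fromℕ< k<n)) (sym (toℕ-fromℕ< l<n)) k≤l))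
  where k<n = ≤-<-trans k≤l l<n

step-bound : ∀ {m n} (p : DyckPath m n) {k} → k < n → ⟦ p ⟧ k ≤ m * k
step-bound {m} p k<n =
  subst₂ _≤_ (!-fromℕ< (seq p) k<n) (cong (m *_) (toℕ-fromℕ< k<n)) (bound p (fromℕ< k<n))

≤[]-antisym : ∀ {m n} (p q : DyckPath m n) →
              ⟦ p ⟧ ≤[ n ] ⟦ q ⟧ → ⟦ q ⟧ ≤[ n ] ⟦ p ⟧ → seq p ≡ seq q
≤[]-antisym p q p≤q q≤p = !-ext (seq p) (seq q) (λ k k<n → ≤-antisym (p≤q k k<n) (q≤p k k<n))

Primitive : ℕ → (ℕ → ℕ) → ℕ → ℕ → Set
Primitive m u i j = i ≤ j × (∀ j' → i < j' → j' ≤ j → u j' + m * i < u i + m * j')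

primitive-refl : ∀ m u i → Primitive m u i i
primitive-refl m u i = ≤-refl , λ j' i<j' j'≤i → ⊥-elim (<-irrefl refl (<-≤-trans i<j' j'≤i))

InPrim⇒Primitive : ∀ {m n} (v : Vec ℕ n) (i j : Fin n) →
                   InPrim m v i j → Primitive m (v !_) (toℕ i) (toℕ j)
InPrim⇒Primitive {m} v i j (i≤j , prim) = i≤j , λ j' i<j' j'≤j →
  let j'<n = ≤-<-trans j'≤j (toℕ<n j)
      eq   = toℕ-fromℕ< j'<n
  in subst₂ _<_ (cong (_+ m * toℕ i) (!-fromℕ< v j'<n))
                 (cong₂ (λ a b → a + m * b) (sym (!-lookup v i)) eq)
       (prim (fromℕ< j'<n) (subst (toℕ i <_) (sym eq) i<j') (subst (_≤ toℕ j) (sym eq) j'≤j))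

Primitive⇒InPrim : ∀ {m n} (v : Vec ℕ n) (i j : Fin n) →
                   Primitive m (v !_) (toℕ i) (toℕ j) → InPrim m v i j
Primitive⇒InPrim {m} v i j (i≤j , prim) = i≤j , λ j' i<j' j'≤j →
  subst₂ _<_ (cong (_+ m * toℕ i) (!-lookup v j')) (cong (_+ m * toℕ j') (!-lookup v i))
    (prim (toℕ j') i<j' j'≤j)

inPrim? : ∀ {n} m (v : Vec ℕ n) i j → Dec (InPrim m v i j)
inPrim? m v i j = (toℕ i ≤? toℕ j) ×-dec
  all? (λ j' → (toℕ i <? toℕ j') →-dec
                 ((toℕ j' ≤? toℕ j) →-dec (lookup v j' + m * toℕ i <? lookup v i + m * toℕ j')))

Moves : ℕ → ℕ → (ℕ → ℕ) → (ℕ → ℕ) → ℕ → Set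
Moves m n x y i = ∀ j → j < n → Primitive m x i j × y j + 1 ≡ x j ⊎ ¬ Primitive m x i j × y j ≡ x j

-- RotStep on ℕ-indexed step sequences: x rotates to y at the 0-based position suc i₀.
record Rotation (m n : ℕ) (x y : ℕ → ℕ) : Set where
  field
    i₀     : ℕ
    i<n    : suc i₀ < n
    ascent : x i₀ < x (suc i₀)
    moves  : Moves m n x y (suc i₀)

toRotation : ∀ {m n} {x y : DyckPath m n} → RotStep x y → Rotation m n ⟦ x ⟧ ⟦ y ⟧
toRotation {m} {n} {x} {y} (i₀ , i , i≡ , asc , moves) = record
  { i₀     = toℕ i₀
  ; i<n    = subst (_< n) i≡ (toℕ<n i)
  ; ascent = subst₂ _<_ (sym (!-lookup (seq x) i₀)) (trans (sym (!-lookup (seq x) i)) (cong ⟦ x ⟧ i≡)) asc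
  ; moves  = subst (Moves m n ⟦ x ⟧ ⟦ y ⟧) i≡ move
  }
  where
  move : Moves m n ⟦ x ⟧ ⟦ y ⟧ (toℕ i)
  move j j<n with inPrim? m (seq x) i (fromℕ< j<n) | moves (fromℕ< j<n)
  ... | yes ip  | (lowered , _) =
    inj₁ ( subst (Primitive m ⟦ x ⟧ (toℕ i)) (toℕ-fromℕ< j<n) (InPrim⇒Primitive {m} (seq x) i _ ip)
         , subst₂ (λ a b → a + 1 ≡ b) (!-fromℕ< (seq y) j<n) (!-fromℕ< (seq x) j<n) (lowered ip))
  ... | no ¬ip | (_ , kept) =
    inj₂ ( (λ prim → ¬ip (Primitive⇒InPrim {m} (seq x) i _
                              (subst (Primitive m ⟦ x ⟧ (toℕ i)) (sym (toℕ-fromℕ< j<n)) prim)))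
         , subst₂ _≡_ (!-fromℕ< (seq y) j<n) (!-fromℕ< (seq x) j<n) (kept ¬ip))

fromRotation : ∀ {m n} {x y : DyckPath m n} → Rotation m n ⟦ x ⟧ ⟦ y ⟧ → RotStep x y
fromRotation {m} {n} {x} {y} R =
  fromℕ< i₀<n , fromℕ< i<n , trans (toℕ-fromℕ< i<n) (cong suc (sym (toℕ-fromℕ< i₀<n))) ,
  subst₂ _<_ (sym (!-fromℕ< (seq x) i₀<n)) (sym (!-fromℕ< (seq x) i<n)) ascent , move
  where
  open Rotation R
  i₀<n = <-trans (n<1+n i₀) i<n
  at-i : ∀ {j} → Primitive m ⟦ x ⟧ (suc i₀) (toℕ j) → InPrim m (seq x) (fromℕ< i<n) j
  at-i prim = Primitive⇒InPrim {m} (seq x) _ _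
                (subst (λ z → Primitive m ⟦ x ⟧ z _) (sym (toℕ-fromℕ< i<n)) prim)
  move : (j : Fin n) →
    (InPrim m (seq x) (fromℕ< i<n) j → lookup (seq y) j + 1 ≡ lookup (seq x) j) ×
    (¬ InPrim m (seq x) (fromℕ< i<n) j → lookup (seq y) j ≡ lookup (seq x) j)
  move j with moves (toℕ j) (toℕ<n j)
  ... | inj₁ (prim , lowered) =
    (λ _ → subst₂ (λ a b → a + 1 ≡ b) (!-lookup (seq y) j) (!-lookup (seq x) j) lowered) ,
    (λ ¬ip → ⊥-elim (¬ip (at-i prim)))
  ... | inj₂ (¬prim , kept) =
    (λ ip → ⊥-elim (¬prim (subst (λ z → Primitive m ⟦ x ⟧ z _) (toℕ-fromℕ< i<n)
                              (InPrim⇒Primitive {m} (seq x) _ j ip)))) ,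
    (λ _ → subst₂ _≡_ (!-lookup (seq y) j) (!-lookup (seq x) j) kept)

rotation-decreases : ∀ {m n x y} → Rotation m n x y → y ≤[ n ] x
rotation-decreases R k k<n with Rotation.moves R k k<n
... | inj₁ (_ , lowered) = subst (_ ≤_) lowered (m≤m+n _ 1)
... | inj₂ (_ , kept)    = ≤-reflexive kept

rotation-lowers : ∀ {m n x y} (R : Rotation m n x y) →
                  y (suc (Rotation.i₀ R)) + 1 ≡ x (suc (Rotation.i₀ R))
rotation-lowers {m} {x = x} R with Rotation.moves R _ (Rotation.i<n R)
... | inj₁ (_ , lowered) = lowered
... | inj₂ (¬prim , _)   = ⊥-elim (¬prim (primitive-refl m x _))

rot-changes : ∀ {m n} {x y : DyckPath m n} → RotStep x y → seq x ≢ seq y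
rot-changes {x = x} {y} s x≡y = m+1+n≢m (⟦ y ⟧ i) (trans (rotation-lowers R) (cong (_! i) x≡y))
  where
  R = toRotation {x = x} {y} s
  i = suc (Rotation.i₀ R)

RotStable : ℕ → ℕ → ((ℕ → ℕ) → Set) → Set
RotStable m n P = ∀ {x y} → Rotation m n x y → P x → P y

star-preserves : ∀ {m n P} → RotStable m n P →
                 {x y : DyckPath m n} → x ≤rot y → P ⟦ x ⟧ → P ⟦ y ⟧
star-preserves stable ε        Px = Px
star-preserves stable {x} (_◅_ {j = z} s xs) Px =
  star-preserves stable xs (stable (toRotation {x = x} {z} s) Px)

≤[]-stable : ∀ {m n} v → RotStable m n (_≤[ n ] v)
≤[]-stable v R x≤v k k<n = ≤-trans (rotation-decreases R k k<n) (x≤v k k<n)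

≤rot-decreases : ∀ {m n} {x y : DyckPath m n} → x ≤rot y → ⟦ y ⟧ ≤[ n ] ⟦ x ⟧
≤rot-decreases {x = x} x≤y = star-preserves (≤[]-stable ⟦ x ⟧) x≤y (λ _ _ → ≤-refl)

-- For t = 0 these are the inequalities defining primitive subsequences; rotations never break them.
Slack : ℕ → ℕ → ℕ → ℕ → (ℕ → ℕ) → Set
Slack m t k l u = ∀ j → k < j → j ≤ l → u j + m * k + t < u k + m * j

cross-<-trans : ∀ a b c x y z t → a + y + t < b + z → b + x < c + y → a + x < c + z
cross-<-trans a b c x y z t h₁ h₂ =
  +-cancelʳ-< (b + y) (a + x) (c + z)
    (≤-<-trans (+-monoʳ-≤ (a + x) (m≤n+m (b + y) t))
      (subst₂ _<_ (left a b x y t) (right b c y z) (+-mono-< h₁ h₂)))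
  where
  left : ∀ a b x y t → a + y + t + (b + x) ≡ a + x + (t + (b + y))
  left = solve-∀
  right : ∀ b c y z → b + z + (c + y) ≡ c + z + (b + y)
  right = solve-∀

cross-<-pred : ∀ a b x y t → a + 1 + x + t < b + 1 + y → a + x + t < b + y
cross-<-pred a b x y t h = +-cancelˡ-< 1 _ _ (subst₂ _<_ (left a x t) (right b y) h)
  where
  left : ∀ a x t → a + 1 + x + t ≡ 1 + (a + x + t)
  left = solve-∀
  right : ∀ b y → b + 1 + y ≡ 1 + (b + y)
  right = solve-∀

primitive-extend : ∀ {m t u i k l} → Primitive m u i k → Slack m t k l u →
                   ∀ j → k ≤ j → j ≤ l → Primitive m u i j
primitive-extend {m} {t} {u} {i} {k} (i≤k , prim) slack j k≤j j≤l = ≤-trans i≤k k≤j , go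
  where
  go : ∀ j' → i < j' → j' ≤ j → u j' + m * i < u i + m * j'
  go j' i<j' j'≤j with j' ≤? k | m≤n⇒m<n∨m≡n i≤k
  ... | yes j'≤k | _         = prim j' i<j' j'≤k
  ... | no  j'≰k | inj₁ i<k  = cross-<-trans (u j') (u k) (u i) (m * i) (m * k) (m * j') t
                                 (slack j' (≰⇒> j'≰k) (≤-trans j'≤j j≤l)) (prim k i<k ≤-refl)
  ... | no  j'≰k | inj₂ refl = ≤-<-trans (m≤m+n _ t) (slack j' (≰⇒> j'≰k) (≤-trans j'≤j j≤l))

rotation-preserves-slack : ∀ {m n t k l x y} → Rotation m n x y → l < n →
                           Slack m t k l x → Slack m t k l y
rotation-preserves-slack {m} {n} {t} {k} {l} {x} {y} R l<n slack j k<j j≤l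
  with Rotation.moves R k (<-≤-trans k<j (≤-trans j≤l (<⇒≤ l<n))) | Rotation.moves R j j<n
  where j<n = ≤-<-trans j≤l l<n
... | inj₂ (_ , kept) | _ =
  subst (λ z → y j + m * k + t < z + m * j) (sym kept)
    (≤-<-trans (+-monoˡ-≤ t (+-monoˡ-≤ (m * k) (rotation-decreases R j (≤-<-trans j≤l l<n))))
               (slack j k<j j≤l))
... | inj₁ (prim-k , _) | inj₂ (¬prim-j , _) =
  ⊥-elim (¬prim-j (primitive-extend {m} {t} {x} prim-k slack j (<⇒≤ k<j) j≤l))
... | inj₁ (_ , lowered-k) | inj₁ (_ , lowered-j) =
  cross-<-pred (y j) (y k) (m * k) (m * j) t
    (subst₂ (λ a b → a + m * k + t < b + m * j) (sym lowered-j) (sym lowered-k) (slack j k<j j≤l))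

slack-stable : ∀ {m n} t k l → l < n → RotStable m n (Slack m t k l)
slack-stable t k l l<n R = rotation-preserves-slack R l<n

sum-mono : ∀ {n} (v w : Vec ℕ n) → (v !_) ≤[ n ] (w !_) → sum v ≤ sum w
sum-mono []      []      _   = ≤-refl
sum-mono (x ∷ v) (y ∷ w) v≤w =
  +-mono-≤ (v≤w 0 (s≤s z≤n)) (sum-mono v w (λ k k<n → v≤w (suc k) (s≤s k<n)))

sum-strict : ∀ {n} (v w : Vec ℕ n) → (v !_) ≤[ n ] (w !_) → v ≢ w → sum v < sum w
sum-strict []      []      _   v≢w = ⊥-elim (v≢w refl)
sum-strict (x ∷ v) (y ∷ w) v≤w v≢w with m≤n⇒m<n∨m≡n (v≤w 0 (s≤s z≤n))
... | inj₁ x<y  = +-mono-<-≤ x<y (sum-mono v w (λ k k<n → v≤w (suc k) (s≤s k<n)))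
... | inj₂ refl = +-monoʳ-< x (sum-strict v w (λ k k<n → v≤w (suc k) (s≤s k<n)) (v≢w ∘ cong (x ∷_)))

<rot-sum : ∀ {m n} {x y : DyckPath m n} → x <rot y → sum (seq y) < sum (seq x)
<rot-sum (x≤y , x≢y) = sum-strict _ _ (≤rot-decreases x≤y) (x≢y ∘ sym)

unsnoc : ∀ {A : Set} {T : A → A → Set} {i j k} → T i j → Star T j k → Σ A λ l → Star T i l × T l k
unsnoc t ε         = _ , ε , t
unsnoc t (t' ◅ ts) with unsnoc t' ts
... | l , ts' , t'' = l , t ◅ ts' , t''

<rot-last : ∀ {m n} {r p : DyckPath m n} → r <rot p → Σ (DyckPath m n) λ x → r ≤rot x × RotStep x p
<rot-last (ε      , r≢p) = ⊥-elim (r≢p refl)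
<rot-last (s ◅ ss , _)   = unsnoc s ss

OnlyLowerCover : ∀ {m n} → DyckPath m n → DyckPath m n → Set
OnlyLowerCover {m} {n} q p = (q' : DyckPath m n) → LowerCover q' p → seq q' ≡ seq q

-- Whether r is itself a lower cover of p is undecidable, hence the double negation.
below-only-cover : ∀ {m n} {p q : DyckPath m n} → OnlyLowerCover q p →
  ∀ N (r : DyckPath m n) → sum (seq r) < N → r <rot p →
  ¬ ¬ (Σ (DyckPath m n) λ x → r ≤rot x × seq x ≡ seq q)
below-only-cover {m} {n} {p} {q} only (suc N) r (s≤s r<N) r<p ¬goal =
  ¬goal (r , ε , only r (r<p , ¬between))
  where
  ¬between : ¬ (Σ (DyckPath m n) λ r' → r <rot r' × r' <rot p)
  ¬between (r' , r<r' , r'<p) =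
    below-only-cover {p = p} {q} only N r' (<-≤-trans (<rot-sum r<r') r<N) r'<p
      (λ (x , r'≤x , x≡q) → ¬goal (x , proj₁ r<r' ◅◅ r'≤x , x≡q))

only-cover-inherits : ∀ {m n P} {p q r : DyckPath m n} → OnlyLowerCover q p → RotStable m n P →
                      RotStep r p → P ⟦ r ⟧ → ¬ ¬ P ⟦ q ⟧
only-cover-inherits {P = P} {p} {q} {r} only stable s Pr ¬Pq =
  below-only-cover {p = p} {q} only (suc (sum (seq r))) r ≤-refl
    (s ◅ ε , rot-changes {x = r} {p} s)
    (λ (x , r≤x , x≡q) → ¬Pq (subst (λ v → P (v !_)) x≡q (star-preserves stable r≤x Pr)))

raise : (ℕ → ℕ) → ℕ → ℕ → ℕ → ℕ
raise u i e k with (i ≤? k) ×-dec (k ≤? e)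
... | yes _ = suc (u k)
... | no  _ = u k

raise-in : ∀ u {i e k} → i ≤ k × k ≤ e → raise u i e k ≡ suc (u k)
raise-in u {i} {e} {k} k∈ with (i ≤? k) ×-dec (k ≤? e)
... | yes _ = refl
... | no k∉ = ⊥-elim (k∉ k∈)

raise-out : ∀ u {i e k} → ¬ (i ≤ k × k ≤ e) → raise u i e k ≡ u k
raise-out u {i} {e} {k} k∉ with (i ≤? k) ×-dec (k ≤? e)
... | yes k∈ = ⊥-elim (k∉ k∈)
... | no _   = refl

-- Undoing a rotation at i whose primitive subsequence is the interval [i, e].
module Raise {m n} (p : DyckPath m n) (i₀ e : ℕ) (e<n : e < n)
  (below : ⟦ p ⟧ (suc i₀) < m * suc i₀)
  (prim : Primitive m ⟦ p ⟧ (suc i₀) e)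
  (stops : suc e < n → ⟦ p ⟧ (suc i₀) + m * suc e < ⟦ p ⟧ (suc e) + m * suc i₀) where

  private
    u = ⟦ p ⟧
    i = suc i₀
    v = raise u i e
    i≤e = proj₁ prim
    i<n = ≤-<-trans i≤e e<n
    i∈ : i ≤ i × i ≤ e
    i∈ = ≤-refl , i≤e

  stops-within : ∀ k → i ≤ k → k ≤ e → suc e < n → u k + m * suc e < u (suc e) + m * k
  stops-within k i≤k k≤e se<n with m≤n⇒m<n∨m≡n i≤k
  ... | inj₂ refl = stops se<n
  ... | inj₁ i<k  = cross-<-trans (u k) (u i) (u (suc e)) (m * suc e) (m * i) (m * k) 0
                      (subst (_< u i + m * k) (sym (+-identityʳ _)) (proj₂ prim k i<k k≤e)) (stops se<n)

  raise-mono : ∀ k l → k ≤ l → l < n → v k ≤ v l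
  raise-mono k l k≤l l<n with (i ≤? k) ×-dec (k ≤? e) | (i ≤? l) ×-dec (l ≤? e)
  ... | yes _  | yes _ = s≤s (step-mono p k≤l l<n)
  ... | no _   | yes _ = ≤-trans (step-mono p k≤l l<n) (n≤1+n _)
  ... | no _   | no _  = step-mono p k≤l l<n
  ... | yes (i≤k , k≤e) | no l∉ = ≤-trans (+-cancelʳ-< (m * k) (u k) (u (suc e)) jump) (step-mono p e<l l<n)
    where
    e<l : e < l
    e<l = ≰⇒> (λ l≤e → l∉ (≤-trans i≤k k≤l , l≤e))
    jump : u k + m * k < u (suc e) + m * k
    jump = ≤-<-trans (+-monoʳ-≤ (u k) (*-monoʳ-≤ m (m≤n⇒m≤1+n k≤e)))
             (stops-within k i≤k k≤e (≤-<-trans e<l l<n))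

  raise-bound : ∀ k → k < n → v k ≤ m * k
  raise-bound k k<n with (i ≤? k) ×-dec (k ≤? e)
  ... | no _ = step-bound p k<n
  ... | yes (i≤k , k≤e) with m≤n⇒m<n∨m≡n i≤k
  ...   | inj₂ refl = below
  ...   | inj₁ i<k  = +-cancelʳ-< (m * i) (u k) (m * k)
                        (subst (u k + m * i <_) (+-comm (m * i) (m * k))
                          (<-trans (proj₂ prim k i<k k≤e) (+-monoˡ-< (m * k) below)))

  path : DyckPath m n
  path = dyck (tabulate (v ∘ toℕ))
    (λ a b a≤b → subst₂ _≤_ (sym (lookup∘tabulate _ a)) (sym (lookup∘tabulate _ b))
                   (raise-mono (toℕ a) (toℕ b) a≤b (toℕ<n b)))
    (λ j → subst (_≤ m * toℕ j) (sym (lookup∘tabulate _ j)) (raise-bound (toℕ j) (toℕ<n j)))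

  steps : ∀ k → k < n → ⟦ path ⟧ k ≡ raise u i e k
  steps k = !-tabulate v

  raised-in : ∀ {k} → k < n → i ≤ k × k ≤ e → ⟦ path ⟧ k ≡ suc (u k)
  raised-in k<n k∈ = trans (steps _ k<n) (raise-in u k∈)

  raised-out : ∀ {k} → k < n → ¬ (i ≤ k × k ≤ e) → ⟦ path ⟧ k ≡ u k
  raised-out k<n k∉ = trans (steps _ k<n) (raise-out u k∉)

  not-primitive-after : ∀ {j} → j < n → e < j → ¬ Primitive m ⟦ path ⟧ i j
  not-primitive-after j<n e<j (_ , prim') =
    <-irrefl refl (<-≤-trans (stops se<n) (≤-pred (subst₂ (λ a b → a + m * i < b + m * suc e)
      (raised-out se<n (λ (_ , se≤e) → <-irrefl refl se≤e)) (raised-in i<n i∈)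
      (prim' (suc e) (s≤s i≤e) e<j))))
    where se<n = ≤-<-trans e<j j<n

  rotation : Rotation m n ⟦ path ⟧ u
  rotation = record
    { i₀     = i₀
    ; i<n    = i<n
    ; ascent = subst₂ _<_ (sym (raised-out (<-trans (n<1+n i₀) i<n) λ (i≤i₀ , _) → <-irrefl refl i≤i₀))
                          (sym (raised-in i<n i∈)) (s≤s (step-mono p (n≤1+n i₀) i<n))
    ; moves  = move
    }
    where
    move : Moves m n ⟦ path ⟧ u i
    move j j<n with (i ≤? j) ×-dec (j ≤? e)
    ... | yes j∈@(i≤j , j≤e) =
      inj₁ ( (i≤j , λ j' i<j' j'≤j → subst₂ (λ a b → a + m * i < b + m * j')
                (sym (raised-in (≤-<-trans j'≤j j<n) (<⇒≤ i<j' , ≤-trans j'≤j j≤e)))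
                (sym (raised-in i<n i∈))
                (s≤s (proj₂ prim j' i<j' (≤-trans j'≤j j≤e))))
           , trans (+-comm (u j) 1) (sym (raised-in j<n j∈)))
    ... | no j∉ = inj₂ (¬prim , sym (raised-out j<n j∉))
      where
      ¬prim : ¬ Primitive m ⟦ path ⟧ i j
      ¬prim prim' = not-primitive-after j<n (≰⇒> (λ j≤e → j∉ (proj₁ prim' , j≤e))) prim'

  rotates : RotStep path p
  rotates = fromRotation {x = path} {p} rotation

single-predecessor⇒join-irreducible : ∀ {m n} {p r : DyckPath m n} → RotStep r p →
  (∀ x → RotStep x p → seq x ≡ seq r) → JoinIrreducible p
single-predecessor⇒join-irreducible {m} {n} {p} {r} r⋖p unique = not-minimal , r , cover , only
  where
  r<p : r <rot p
  r<p = r⋖p ◅ ε , rot-changes {x = r} {p} r⋖p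

  not-minimal : ¬ Minimal p
  not-minimal minimal = minimal (r , r<p)

  cover : LowerCover r p
  cover = r<p , λ (r' , (r≤r' , r≢r') , r'<p) →
    let (x , r'≤x , x⋖p) = <rot-last r'<p
    in r≢r' (≤[]-antisym r r'
              (subst (λ w → (w !_) ≤[ n ] ⟦ r' ⟧) (unique x x⋖p) (≤rot-decreases r'≤x))
              (≤rot-decreases r≤r'))

  only : OnlyLowerCover r p
  only q' (q'<p , ¬between) with ≡-dec _≟_ (seq q') (seq r)
  ... | yes q'≡r = q'≡r
  ... | no  q'≢r =
    let (x , q'≤x , x⋖p) = <rot-last q'<p
    in ⊥-elim (¬between (x , (q'≤x , λ q'≡x → q'≢r (trans q'≡x (unique x x⋖p))) ,
                             (x⋖p ◅ ε , rot-changes {x = x} {p} x⋖p)))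

<-+-flip : ∀ {a b c d} → a < b → c ≡ d → a + d < c + b
<-+-flip {a} {b} {c} a<b refl = subst (a + c <_) (+-comm b c) (+-monoˡ-< c a<b)

ShapeAt : ℕ → (ℕ → ℕ) → ℕ → ℕ → ℕ → ℕ → Set
ShapeAt m u a b s k = (a < k × k ≤ b → u k + s ≡ m * k) × (¬ (a < k × k ≤ b) → u k ≡ m * k)

Shape : ℕ → ℕ → (ℕ → ℕ) → ℕ → ℕ → ℕ → Set
Shape m n u a b s = ∀ k → k < n → ShapeAt m u a b s k

module Shaped {m n} (p : DyckPath m n) {a b₀ s} (a<b : a < suc b₀) (b<n : suc b₀ < n) (1≤s : 1 ≤ s)
              (shape : Shape m n ⟦ p ⟧ a (suc b₀) s) where

  private
    u = ⟦ p ⟧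
    b = suc b₀

  lowered-by-s : ∀ {k} → k < n → a < k → k ≤ b → u k + s ≡ m * k
  lowered-by-s k<n a<k k≤b = proj₁ (shape _ k<n) (a<k , k≤b)

  flat-outside : ∀ {k} → k < n → ¬ (a < k × k ≤ b) → u k ≡ m * k
  flat-outside k<n = proj₂ (shape _ k<n)

  balanced : ∀ {k l} → k < n → l < n → a < k × k ≤ b → a < l × l ≤ b → u k + m * l ≡ u l + m * k
  balanced {k} {l} k<n l<n (a<k , k≤b) (a<l , l≤b) = +-cancelʳ-≡ s _ _ (begin
    u k + m * l + s   ≡⟨ xy∙z≈xz∙y (u k) (m * l) s ⟩
    u k + s + m * l   ≡⟨ cong (_+ m * l) (lowered-by-s k<n a<k k≤b) ⟩
    m * k + m * l     ≡⟨ +-comm (m * k) (m * l) ⟩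
    m * l + m * k     ≡⟨ cong (_+ m * k) (lowered-by-s l<n a<l l≤b) ⟨
    u l + s + m * k   ≡⟨ xy∙z≈xz∙y (u l) s (m * k) ⟩
    u l + m * k + s   ∎)
    where open ≡-Reasoning

  below-at-end : u b < m * b
  below-at-end = subst (u b <_) (lowered-by-s b<n a<b ≤-refl) (m<m+n (u b) 1≤s)

  module Predecessor = Raise p b₀ b b<n below-at-end (primitive-refl m u b)
    (λ b+1<n → <-+-flip below-at-end (flat-outside b+1<n (λ (_ , b+1≤b) → <-irrefl refl b+1≤b)))

  rotation-at-end : (x : DyckPath m n) (R : Rotation m n ⟦ x ⟧ u) → suc (Rotation.i₀ R) ≡ b
  rotation-at-end x R = [ ⊥-elim ∘ not-before-end , id ]′ (m≤n⇒m<n∨m≡n (proj₂ i∈))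
    where
    open Rotation R
    i = suc i₀
    lowered : ⟦ x ⟧ i ≡ suc (u i)
    lowered = trans (sym (rotation-lowers R)) (+-comm (u i) 1)
    i∈ : a < i × i ≤ b
    i∈ with (a <? i) ×-dec (i ≤? b)
    ... | yes i∈ = i∈
    ... | no  i∉ = ⊥-elim (<-irrefl (flat-outside i<n i∉) (subst (_≤ m * i) lowered (step-bound x i<n)))
    -- Both i and i + 1 lie in (a, b], where u grows by exactly m,
    -- so either way the move at i + 1 is inconsistent.
    not-before-end : i < b → ⊥
    not-before-end i<b = next-moves (moves (suc i) j<n)
      where
      j<n = ≤-<-trans i<b b<n
      bal : u (suc i) + m * i ≡ u i + m * suc i
      bal = balanced j<n i<n (<-trans (proj₁ i∈) (n<1+n i) , i<b) i∈
      next-moves : Primitive m ⟦ x ⟧ i (suc i) × u (suc i) + 1 ≡ ⟦ x ⟧ (suc i)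
                 ⊎ ¬ Primitive m ⟦ x ⟧ i (suc i) × u (suc i) ≡ ⟦ x ⟧ (suc i) → ⊥
      next-moves (inj₁ (prim , lowered-j)) = <-irrefl (cong suc bal)
        (subst₂ (λ c d → c + m * i < d + m * suc i) (trans (sym lowered-j) (+-comm _ 1)) lowered
          (proj₂ prim (suc i) ≤-refl ≤-refl))
      next-moves (inj₂ (¬prim , kept)) = ¬prim (n≤1+n i , λ j' i<j' j'≤j → subst
        (λ j → ⟦ x ⟧ j + m * i < ⟦ x ⟧ i + m * j) (sym (≤-antisym j'≤j i<j'))
        (subst₂ (λ c d → c + m * i < d + m * suc i) kept (sym lowered)
          (subst (_< suc (u i + m * suc i)) (sym bal) ≤-refl)))

  predecessor-unique : ∀ x → RotStep x p → seq x ≡ seq Predecessor.path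
  predecessor-unique x x⋖p = !-ext (seq x) (seq Predecessor.path) agree
    where
    R = toRotation {x = x} {p} x⋖p
    i≡b = rotation-at-end x R
    agree : ∀ l → l < n → ⟦ x ⟧ l ≡ ⟦ Predecessor.path ⟧ l
    agree l l<n with Rotation.moves R l l<n
    ... | inj₁ ((i≤l , _) , lowered) with m≤n⇒m<n∨m≡n (subst (_≤ l) i≡b i≤l)
    ...   | inj₂ refl =
      trans (sym lowered) (trans (+-comm (u b) 1) (sym (Predecessor.raised-in b<n (≤-refl , ≤-refl))))
    ...   | inj₁ b<l  = ⊥-elim (<-irrefl refl (<-≤-trans
            (subst (m * l <_)
              (trans (cong (_+ 1) (sym (flat-outside l<n λ (_ , l≤b) → <-irrefl refl (<-≤-trans b<l l≤b))))
                     lowered)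
              (m<m+n (m * l) (s≤s z≤n)))
            (step-bound x l<n)))
    agree l l<n | inj₂ (¬prim , kept) = trans (sym kept) (sym (Predecessor.raised-out l<n l∉))
      where
      l∉ : ¬ (b ≤ l × l ≤ b)
      l∉ (b≤l , l≤b) =
        ¬prim (subst (Primitive m ⟦ x ⟧ _) (trans i≡b (≤-antisym b≤l l≤b)) (primitive-refl m ⟦ x ⟧ _))

  join-irreducible : JoinIrreducible p
  join-irreducible =
    single-predecessor⇒join-irreducible {r = Predecessor.path} Predecessor.rotates predecessor-unique

search-last : (P : ℕ → Set) → (∀ k → Dec (P k)) → (b : ℕ) →
  (Σ ℕ λ k → k < b × P k × (∀ k' → k < k' → k' < b → ¬ P k')) ⊎ (∀ k → k < b → ¬ P k)
search-last P P? zero = inj₂ (λ _ ())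
search-last P P? (suc b) with P? b | search-last P P? b
... | yes Pb  | _ =
  inj₁ (b , ≤-refl , Pb , λ k' b<k' k'<1+b _ → <-irrefl refl (<-≤-trans b<k' (≤-pred k'<1+b)))
... | no  ¬Pb | inj₁ (k , k<b , Pk , after) = inj₁ (k , m≤n⇒m≤1+n k<b , Pk , after′)
  where
  after′ : ∀ k' → k < k' → k' < suc b → ¬ P k'
  after′ k' k<k' k'<1+b with m≤n⇒m<n∨m≡n (≤-pred k'<1+b)
  ... | inj₁ k'<b = after k' k<k' k'<b
  ... | inj₂ refl = ¬Pb
... | no  ¬Pb | inj₂ none = inj₂ none′
  where
  none′ : ∀ k → k < suc b → ¬ P k
  none′ k k<1+b with m≤n⇒m<n∨m≡n (≤-pred k<1+b)
  ... | inj₁ k<b  = none k k<b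
  ... | inj₂ refl = ¬Pb

mono-by-steps : (f : ℕ → ℕ) {K : ℕ} → (∀ l → l < K → f l ≤ f (suc l)) →
                ∀ {x y} → x ≤ y → y ≤ K → f x ≤ f y
mono-by-steps f steps {y = zero}  z≤n  _    = ≤-refl
mono-by-steps f steps {x} {suc y} x≤y′ y′≤K with m≤n⇒m<n∨m≡n x≤y′
... | inj₂ refl      = ≤-refl
... | inj₁ (s≤s x≤y) =
  ≤-trans (mono-by-steps f steps x≤y (≤-trans (n≤1+n y) y′≤K)) (steps y y′≤K)

-- Truncated subtraction is harmless here since u k ≤ m k.
defect : ∀ {m n} → DyckPath m n → ℕ → ℕ
defect {m} p k = m * k ∸ ⟦ p ⟧ k

module _ {m n} (p : DyckPath m n) where

  private
    u = ⟦ p ⟧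
    D = defect p

  defect-spec : ∀ {k} → k < n → u k + D k ≡ m * k
  defect-spec k<n = m+[n∸m]≡n (step-bound p k<n)

  defect-zero : D 0 ≡ 0
  defect-zero = trans (cong (_∸ u 0) (*-zeroʳ m)) (0∸n≡0 (u 0))

  defect-pos⇒below : ∀ {k} → k < n → 0 < D k → u k < m * k
  defect-pos⇒below {k} k<n 0<Dk = subst (u k <_) (defect-spec k<n) (m<m+n (u k) 0<Dk)

  defect-zero⇒on-diagonal : ∀ {k} → k < n → D k ≡ 0 → u k ≡ m * k
  defect-zero⇒on-diagonal {k} k<n Dk≡0 =
    trans (sym (+-identityʳ (u k))) (trans (cong (u k +_) (sym Dk≡0)) (defect-spec k<n))

  cross-left : ∀ {k} l t → k < n → u l + m * k + t ≡ u l + u k + (D k + t)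
  cross-left {k} l t k<n = trans (cong (λ z → u l + z + t) (sym (defect-spec k<n))) (regroup (u l) (u k) (D k) t)
    where
    regroup : ∀ a b d t → a + (b + d) + t ≡ a + b + (d + t)
    regroup = solve-∀

  cross-right : ∀ k {l} → l < n → u k + m * l ≡ u l + u k + D l
  cross-right k {l} l<n = trans (cong (u k +_) (sym (defect-spec l<n))) (regroup (u l) (u k) (D l))
    where
    regroup : ∀ a b d → b + (a + d) ≡ a + b + d
    regroup = solve-∀

  defect-<⇒cross-< : ∀ {k l} t → k < n → l < n → D k + t < D l → u l + m * k + t < u k + m * l
  defect-<⇒cross-< {k} {l} t k<n l<n Dk+t<Dl =
    subst₂ _<_ (sym (cross-left l t k<n)) (sym (cross-right k l<n)) (+-monoʳ-< (u l + u k) Dk+t<Dl)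

  defect-<⇒cross-<₀ : ∀ {k l} → k < n → l < n → D k < D l → u l + m * k < u k + m * l
  defect-<⇒cross-<₀ {k} {l} k<n l<n Dk<Dl = subst (_< u k + m * l) (+-identityʳ (u l + m * k))
    (defect-<⇒cross-< 0 k<n l<n (subst (_< D l) (sym (+-identityʳ (D k))) Dk<Dl))

  cross-<⇒defect-< : ∀ {k l} t → k < n → l < n → u l + m * k + t < u k + m * l → D k + t < D l
  cross-<⇒defect-< {k} {l} t k<n l<n cross =
    +-cancelˡ-< (u l + u k) _ _ (subst₂ _<_ (cross-left l t k<n) (cross-right k l<n) cross)

  defect-step-bound : ∀ {k} → suc k < n → D (suc k) ≤ D k + m
  defect-step-bound {k} k+1<n = +-cancelˡ-≤ (u (suc k)) _ _ (begin
    u (suc k) + D (suc k)  ≡⟨ defect-spec k+1<n ⟩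
    m * suc k              ≡⟨ *-suc m k ⟩
    m + m * k              ≡⟨ cong (m +_) (defect-spec k<n) ⟨
    m + (u k + D k)        ≤⟨ +-monoʳ-≤ m (+-monoˡ-≤ (D k) (step-mono p (n≤1+n k) k+1<n)) ⟩
    m + (u (suc k) + D k)  ≡⟨ rearrange m (u (suc k)) (D k) ⟩
    u (suc k) + (D k + m)  ∎)
    where
    open ≤-Reasoning
    k<n = <-trans (n<1+n k) k+1<n
    rearrange : ∀ a b c → a + (b + c) ≡ b + (c + a)
    rearrange = solve-∀

HasShape : ℕ → ℕ → (ℕ → ℕ) → Set
HasShape m n u =
  Σ ℕ λ a → Σ ℕ λ b → Σ ℕ λ s → a < b × b < n × 1 ≤ s × s ≤ m × Shape m n u a b s

module Forward {m n} (p q : DyckPath m n) (q<p : q <rot p) (only : OnlyLowerCover q p) where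

  private
    u = ⟦ p ⟧
    v = ⟦ q ⟧
    D = defect p

  p≤q : u ≤[ n ] v
  p≤q = ≤rot-decreases (proj₁ q<p)

  inherits : ∀ {P} {r : DyckPath m n} → RotStable m n P → RotStep r p → P ⟦ r ⟧ → ¬ ¬ P v
  inherits {P} {r} = only-cover-inherits {P = P} {p} {q} {r} only

  module LastDeficit (K₀ : ℕ) (K<n : suc K₀ < n) (below-K : u (suc K₀) < m * suc K₀)
                     (flat-after : ∀ k → suc K₀ < k → k < n → u k ≡ m * k) where

    K = suc K₀

    stops-at-K : ∀ {i} → u i < m * i → suc K < n → u i + m * suc K < u (suc K) + m * i
    stops-at-K below K+1<n = <-+-flip below (flat-after (suc K) ≤-refl K+1<n)

    module AtK = Raise p K₀ K K<n below-K (primitive-refl m u K) (stops-at-K below-K)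

    raised-at-K : ¬ ¬ (u K < v K × (∀ k → k < n → k ≢ K → v k ≤ u k))
    raised-at-K ¬goal = inherits {r = AtK.path} (≤[]-stable ⟦ AtK.path ⟧) AtK.rotates (λ _ _ → ≤-refl)
      λ q≤r → ¬goal (rises q≤r , fixed q≤r)
      where
      fixed : v ≤[ n ] ⟦ AtK.path ⟧ → ∀ k → k < n → k ≢ K → v k ≤ u k
      fixed q≤r k k<n k≢K =
        subst (v k ≤_) (AtK.raised-out k<n (λ (K≤k , k≤K) → k≢K (≤-antisym k≤K K≤k))) (q≤r k k<n)
      rises : v ≤[ n ] ⟦ AtK.path ⟧ → u K < v K
      rises q≤r = ≤∧≢⇒< (p≤q K K<n) λ uK≡vK → proj₂ q<p (≤[]-antisym q p (q≤p uK≡vK) p≤q)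
        where
        q≤p : u K ≡ v K → v ≤[ n ] u
        q≤p uK≡vK k k<n with k ≟ K
        ... | yes refl = ≤-reflexive (sym uK≡vK)
        ... | no  k≢K  = fixed q≤r k k<n k≢K

    drop-impossible : ∀ l → l < K → D (suc l) < D l → ⊥
    drop-impossible zero     _   D1<D0 = n≮0 (subst (D 1 <_) (defect-zero p) D1<D0)
    drop-impossible (suc l₀) l<K drop  = raised-at-K λ (rises , _) →
      inherits {r = AtL.path} (≤[]-stable ⟦ AtL.path ⟧) AtL.rotates (λ _ _ → ≤-refl) λ q≤r →
        <-irrefl refl (<-≤-trans rises (subst (v K ≤_) (AtL.raised-out K<n K∉) (q≤r K K<n)))
      where
      l = suc l₀
      l+1<n = ≤-<-trans l<K K<n
      l<n = <-trans (n<1+n l) l+1<n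
      module AtL = Raise p l₀ l l<n (defect-pos⇒below p l<n (≤-<-trans z≤n drop)) (primitive-refl m u l)
        (λ _ → defect-<⇒cross-<₀ p l+1<n l<n drop)
      K∉ : ¬ (l ≤ K × K ≤ l)
      K∉ (_ , K≤l) = <-irrefl refl (<-≤-trans l<K K≤l)

    D-mono : ∀ {x y} → x ≤ y → y ≤ K → D x ≤ D y
    D-mono = mono-by-steps D (λ l l<K → ≮⇒≥ (drop-impossible l l<K))

    c = D K

    1≤c : 1 ≤ c
    1≤c = m<n⇒0<n∸m below-K

    plateau-starts-on-diagonal : ∀ j → j < K → D j < c →
                                 (∀ {k} → j < k → k ≤ K → c ≤ D k) → D j ≡ 0
    plateau-starts-on-diagonal zero      _   _    _   = defect-zero p
    plateau-starts-on-diagonal (suc j₀) j<K Dj<c c≤D = n≤0⇒n≡0 (≮⇒≥ impossible)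
      where
      j = suc j₀
      j<n = <-trans j<K K<n
      t = c ∸ suc (D j)
      Dj+t+1≡c : D j + suc t ≡ c
      Dj+t+1≡c = trans (+-suc (D j) t) (m+[n∸m]≡n Dj<c)
      Dj+t<D : ∀ {k} → j < k → k ≤ K → D j + t < D k
      Dj+t<D j<k k≤K = <-≤-trans (subst (D j + t <_) Dj+t+1≡c (+-monoʳ-< (D j) (n<1+n t))) (c≤D j<k k≤K)
      impossible : 0 < D j → ⊥
      impossible 0<Dj = inherits {r = Span.path} (slack-stable t j K K<n) Span.rotates span-slack λ q-slack →
        raised-at-K λ (rises , fixed) →
          <-irrefl Dj+t+1≡c (cross-<⇒defect-< p (suc t) j<n K<n (q-too-tight q-slack rises fixed))
        where
        below-j = defect-pos⇒below p j<n 0<Dj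
        prim-j : Primitive m u j K
        prim-j = <⇒≤ j<K , λ l j<l l≤K →
          defect-<⇒cross-<₀ p j<n (≤-<-trans l≤K K<n) (<-≤-trans Dj<c (c≤D j<l l≤K))
        module Span = Raise p j₀ K K<n below-j prim-j (stops-at-K below-j)
        span-slack : Slack m t j K ⟦ Span.path ⟧
        span-slack k j<k k≤K =
          subst₂ (λ a b → a + m * j + t < b + m * k)
            (sym (Span.raised-in k<n (<⇒≤ j<k , k≤K))) (sym (Span.raised-in j<n (≤-refl , <⇒≤ j<K)))
            (s≤s (defect-<⇒cross-< p t j<n k<n (Dj+t<D j<k k≤K)))
          where k<n = ≤-<-trans k≤K K<n
        q-too-tight : Slack m t j K v → u K < v K → (∀ k → k < n → k ≢ K → v k ≤ u k) →
                      u K + m * j + suc t < u j + m * K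
        q-too-tight q-slack uK<vK fixed = begin-strict
          u K + m * j + suc t  ≡⟨ +-suc (u K + m * j) t ⟩
          suc (u K) + m * j + t  ≤⟨ +-monoˡ-≤ t (+-monoˡ-≤ (m * j) uK<vK) ⟩
          v K + m * j + t        <⟨ q-slack K j<K ≤-refl ⟩
          v j + m * K            ≤⟨ +-monoˡ-≤ (m * K) (fixed j j<n (<⇒≢ j<K)) ⟩
          u j + m * K            ∎
          where open ≤-Reasoning

    conclusion : HasShape m n u
    conclusion with search-last (λ j → D j < c) (λ j → D j <? c) K
    ... | inj₂ none = ⊥-elim (none 0 (s≤s z≤n) (subst (_< c) (sym (defect-zero p)) 1≤c))
    ... | inj₁ (j , j<K , Dj<c , after) = j , K , c , j<K , K<n , 1≤c , c≤m , shape
      where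
      c≤D : ∀ {k} → j < k → k ≤ K → c ≤ D k
      c≤D {k} j<k k≤K with m≤n⇒m<n∨m≡n k≤K
      ... | inj₁ k<K  = ≮⇒≥ (after k j<k k<K)
      ... | inj₂ refl = ≤-refl
      Dj≡0 = plateau-starts-on-diagonal j j<K Dj<c c≤D
      on-plateau : ∀ {k} → j < k → k ≤ K → D k ≡ c
      on-plateau j<k k≤K = ≤-antisym (D-mono k≤K ≤-refl) (c≤D j<k k≤K)
      c≤m : c ≤ m
      c≤m = subst₂ _≤_ (on-plateau (n<1+n j) j<K) (cong (_+ m) Dj≡0)
              (defect-step-bound p (≤-<-trans j<K K<n))
      shape : Shape m n u j K c
      shape k k<n =
        (λ (j<k , k≤K) → subst (λ d → u k + d ≡ m * k) (on-plateau j<k k≤K) (defect-spec p k<n)) , outside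
        where
        outside : ¬ (j < k × k ≤ K) → u k ≡ m * k
        outside k∉ with k ≤? j | k ≤? K
        ... | yes k≤j | _       =
          defect-zero⇒on-diagonal p k<n (n≤0⇒n≡0 (subst (D k ≤_) Dj≡0 (D-mono k≤j (<⇒≤ j<K))))
        ... | no  k≰j | yes k≤K = ⊥-elim (k∉ (≰⇒> k≰j , k≤K))
        ... | no  _   | no  k≰K = flat-after k (≰⇒> k≰K) k<n

  conclusion : HasShape m n u
  conclusion with search-last (λ k → u k < m * k) (λ k → u k <? m * k) n
  ... | inj₂ none =
    ⊥-elim (proj₂ q<p (≤[]-antisym q p (λ k k<n → ≤-trans (step-bound q k<n) (≮⇒≥ (none k k<n))) p≤q))
  ... | inj₁ (zero , _ , u0<0 , _) = ⊥-elim (n≮0 (subst (u 0 <_) (*-zeroʳ m) u0<0))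
  ... | inj₁ (suc K₀ , K<n , below-K , after) =
    LastDeficit.conclusion K₀ K<n below-K
      (λ k K<k k<n → ≤-antisym (step-bound p k<n) (≮⇒≥ (after k K<k k<n)))

shape⇒join-irreducible : ∀ {m n} (p : DyckPath m n) {a b s} → a < b → b < n → 1 ≤ s →
                         Shape m n ⟦ p ⟧ a b s → JoinIrreducible p
shape⇒join-irreducible p {b = suc b₀} a<b b<n 1≤s shape = Shaped.join-irreducible p a<b b<n 1≤s shape

ShapeOf : ∀ {m n} → DyckPath m n → ℕ → ℕ → ℕ → Set
ShapeOf {m} {n} p a b s = (j : Fin n) →
  (a < toℕ j × toℕ j ≤ b → lookup (seq p) j + s ≡ m * toℕ j) ×
  (¬ (a < toℕ j × toℕ j ≤ b) → lookup (seq p) j ≡ m * toℕ j)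

Shape⇒ShapeOf : ∀ {m n} (p : DyckPath m n) {a b s} → Shape m n ⟦ p ⟧ a b s → ShapeOf p a b s
Shape⇒ShapeOf p {s = s} shape j =
  (λ j∈ → trans (cong (_+ s) (sym (!-lookup (seq p) j))) (proj₁ (shape (toℕ j) (toℕ<n j)) j∈)) ,
  (λ j∉ → trans (sym (!-lookup (seq p) j)) (proj₂ (shape (toℕ j) (toℕ<n j)) j∉))

ShapeOf⇒Shape : ∀ {m n} (p : DyckPath m n) {a b s} → ShapeOf p a b s → Shape m n ⟦ p ⟧ a b s
ShapeOf⇒Shape {m} p {a} {b} {s} shape k k<n = subst (ShapeAt m ⟦ p ⟧ a b s) (toℕ-fromℕ< k<n)
  ( (λ j∈ → trans (cong (_+ s) (!-lookup (seq p) j)) (proj₁ (shape j) j∈))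
  , (λ j∉ → trans (!-lookup (seq p) j) (proj₂ (shape j) j∉)))
  where j = fromℕ< k<n

proposition3p6 : (m n : ℕ) → 0 < m → 0 < n → (p : DyckPath m n) →
    JoinIrreducible p ⇔
      Σ (Fin n) λ a → Σ (Fin n) λ b → Σ ℕ λ s →
        toℕ a < toℕ b × 1 ≤ s × s ≤ m ×
        ((j : Fin n) →
           (toℕ a < toℕ j × toℕ j ≤ toℕ b → lookup (seq p) j + s ≡ m * toℕ j) ×
           (¬ (toℕ a < toℕ j × toℕ j ≤ toℕ b) → lookup (seq p) j ≡ m * toℕ j))
proposition3p6 m n _ _ p = mk⇔
  (λ (_ , q , (q<p , _) , only) → fin-indexed (Forward.conclusion p q q<p only))
  (λ (a , b , s , a<b , 1≤s , _ , shape) →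
     shape⇒join-irreducible p a<b (toℕ<n b) 1≤s (ShapeOf⇒Shape p shape))
  where
  fin-indexed : HasShape m n ⟦ p ⟧ →
    Σ (Fin n) λ a → Σ (Fin n) λ b → Σ ℕ λ s →
      toℕ a < toℕ b × 1 ≤ s × s ≤ m × ShapeOf p (toℕ a) (toℕ b) s
  fin-indexed (a , b , s , a<b , b<n , 1≤s , s≤m , shape) =
    fromℕ< a<n , fromℕ< b<n , s ,
    subst₂ _<_ (sym (toℕ-fromℕ< a<n)) (sym (toℕ-fromℕ< b<n)) a<b , 1≤s , s≤m ,
    subst₂ (λ a b → ShapeOf p a b s) (sym (toℕ-fromℕ< a<n)) (sym (toℕ-fromℕ< b<n))
      (Shape⇒ShapeOf p shape)
    where a<n = <-trans a<b b<n
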